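{- Let $d\ge2$ and let $(\bar A_{k,n})_{k,n\ge1}$ be the negative $d$-Ostrowski array. Then: (1) each row satisfies $\bar A_{k,n+1}=-d\bar A_{k,n}+\bar A_{k,n-1}$ for all $n\ge2$; (2) each nonzero integer occurs exactly once among the entries $\bar A_{k,n}$, $k,n\ge1$; (3) for every sequence of integers $(B_n)$, not identically zero, satisfying $B_{n+1}=-dB_n+B_{n-1}$, there exists $k$ such that $(\bar A_{k,n})_n$ is tail equivalent to $(B_n)$ or to $(-B_n)$.
   Context: Define $(D_n)$ by $D_0=0$, $D_1=1$, $D_{n+1}=dD_n+D_{n-1}$. An Ostrowski word is a finite word $d_1\cdots d_i$ over $\{0,\dots,d\}$ with $0\le d_1<d$, $0\le d_j\le d$ for $j>1$, and $d_{j-1}=0$ whenever $d_j=d$; it represents $\sum_j d_jD_j$. Every non-negative integer has a unique Ostrowski word with nonzero last digit. An Ostrowski word is trimmed if its last digit is nonzero and it cannot be written as $0v$ with $v$ an Ostrowski word (equivalently, its first digit is nonzero, or its first two digits are $0$ and $d$). Let $w_1,w_2,\dots$ be the trimmed Ostrowski words listed in increasing order of the integers they represent, and $|w_m|$ the length of $w_m$. The $d$-Ostrowski array is $A_{m,n}=$ the integer represented by $0^{n-1}w_m$ ($m,n\ge1$); its rows satisfy $A_{m,n+1}=dA_{m,n}+A_{m,n-1}$ and are extended to all $n\in\mathbb Z$ by this recurrence. The negative $d$-Ostrowski array is $\bar A_{k,n}=A_{k,r_k-n}$ for $k\ge1$, $n\ge1$, where $r_k=1-|w_k|$. Two sequences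 $(X_n)$, $(Y_n)$ are tail equivalent if there is an integer $j$ with $X_n=Y_{n+j}$ for all sufficiently large $n$. -}

module Defs where

open import Data.Nat as ℕ using (ℕ; zero; suc; _<_; _≤_)
open import Data.Integer as ℤ using (ℤ; +_; -[1+_]; ∣_∣)
open import Data.List using (List; []; _∷_; _++_; replicate; length; [_])
open import Data.List.Relation.Unary.All using (All)
open import Data.Product using (Σ; ∃; _×_; _,_)
open import Data.Unit using (⊤)
open import Relation.Binary.PropositionalEquality using (_≡_; _≢_)
open import Relation.Nullary using (¬_)

D : ℕ → ℕ → ℕ
D d zero = 0
D d (suc zero) = 1
D d (suc (suc n)) = d ℕ.* D d (suc n) ℕ.+ D d n

-- A word d_1 ⋯ d_i is a list whose head is d_1.
FirstOK : ℕ → List ℕ → Set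
FirstOK d [] = ⊤
FirstOK d (x ∷ _) = x < d

Adj : ℕ → List ℕ → Set
Adj d (x ∷ y ∷ r) = (y ≡ d → x ≡ 0) × Adj d (y ∷ r)
Adj d _ = ⊤

IsOstrowski : ℕ → List ℕ → Set
IsOstrowski d w = FirstOK d w × All (_≤ d) w × Adj d w

valFrom : ℕ → ℕ → List ℕ → ℕ
valFrom d i [] = 0
valFrom d i (x ∷ r) = x ℕ.* D d i ℕ.+ valFrom d (suc i) r

val : ℕ → List ℕ → ℕ
val d = valFrom d 1

LastNonzero : List ℕ → Set
LastNonzero w = Σ (List ℕ) λ u → Σ ℕ λ x → (w ≡ u ++ [ x ]) × (x ≢ 0)

IsTrimmed : ℕ → List ℕ → Set
IsTrimmed d w =
  IsOstrowski d w × LastNonzero w ×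
  ¬ (Σ (List ℕ) λ v → (w ≡ 0 ∷ v) × IsOstrowski d v)

-- w : ℕ → List ℕ lists the trimmed words w_1, w_2, … (index 0 unused)
-- in increasing order of the integers they represent.
IsTrimmedEnumeration : ℕ → (ℕ → List ℕ) → Set
IsTrimmedEnumeration d w =
  (∀ m → 1 ≤ m → IsTrimmed d (w m)) ×
  (∀ m → 1 ≤ m → val d (w m) < val d (w (suc m))) ×
  (∀ v → IsTrimmed d v → Σ ℕ λ m → (1 ≤ m) × (w m ≡ v))

-- row extension to all integer indices by A_{n+1} = d A_n + A_{n-1},
-- from the values at n ≥ 1.  back j = A_{1-j}.
backRow : ℕ → (ℕ → ℤ) → ℕ → ℤ
backRow d a zero = a 1
backRow d a (suc zero) = a 2 ℤ.- (+ d) ℤ.* a 1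
backRow d a (suc (suc j)) = backRow d a j ℤ.- (+ d) ℤ.* backRow d a (suc j)

Apos : ℕ → List ℕ → ℕ → ℤ
Apos d wm n = + val d (replicate (n ℕ.∸ 1) 0 ++ wm)

Arow : ℕ → List ℕ → ℤ → ℤ
Arow d wm (+ suc k) = Apos d wm (suc k)
Arow d wm (+ zero) = backRow d (Apos d wm) 1
Arow d wm -[1+ k ] = backRow d (Apos d wm) (suc (suc k))

A : ℕ → (ℕ → List ℕ) → ℕ → ℤ → ℤ
A d w m n = Arow d (w m) n

r : (ℕ → List ℕ) → ℕ → ℤ
r w k = + 1 ℤ.- + length (w k)

-- negative array  Ā_{k,n} = A_{k, r_k - n}   (meaningful for k, n ≥ 1)
Abar : ℕ → (ℕ → List ℕ) → ℕ → ℕ → ℤ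
Abar d w k n = A d w k (r w k ℤ.- + n)

-- tail equivalence of sequences indexed by ℕ: an integer j with
-- X n = Y (n + j) for all sufficiently large n.  (For n large, + n + j ≥ 0,
-- so ∣ + n + j ∣ is just n + j.)
TailEquiv : (ℕ → ℤ) → (ℕ → ℤ) → Set
TailEquiv X Y = Σ ℤ λ j → Σ ℕ λ N → ∀ n → N ≤ n → X n ≡ Y ∣ + n ℤ.+ j ∣

-- Write D⁻ n = D_{-n} for the continuation of D to negative indices. Running the row of
-- w_k = x_1 ⋯ x_L backwards gives Ā_{k,n} = Σ_j x_j D_{-(n+L-j)}, so the rows satisfy the
-- recurrence with -d. Up to y ↦ 1 - y, these sums for n = 1 form a numeration system on the
-- admissible words (digits ≤ d, each d preceded by 0) of a fixed length q: they fill an interval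
-- of D_q + D_{q+1} integers exactly once, the leading digit selecting a block of length D_{q+1}.
-- Stripping the leading and trailing zeros of the word representing z gives the unique position
-- of z in Ā. For (3), B continued to negative indices solves the recurrence with +d, so it
-- eventually has a constant sign (a Euclid-like descent); replacing B by -B, it is eventually
-- positive. Let u represent B_N for N large. Far to the left, the continuations of B and of the
-- row of u take values in [0, D_j) and differ by a multiple of D_j, so they agree from N on.

module Submission where

open import Defs
open import Data.Bool using (Bool; true; false; not; if_then_else_)
open import Data.Integer as ℤ using (ℤ; +_; -_; -[1+_]; _+_; _*_; _-_)
import Data.Integer.Properties as ℤP
open import Algebra.Properties.AbelianGroup ℤP.+-0-abelianGroup using (∙-cancelˡ)
open import Data.Integer.Tactic.RingSolver using (solve-∀)
open import Data.List using (List; []; _∷_; _++_; replicate; length; [_])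
import Data.List.Properties as LP
open import Data.List.Relation.Unary.All using (All; []; _∷_)
open import Data.Nat as ℕ using (ℕ; zero; suc; _≤_; _<_; _∸_; z≤n; s≤s)
import Data.Nat.Properties as ℕP
import Data.Nat.Tactic.RingSolver as ℕSolver
open import Data.Product using (Σ; _×_; _,_; proj₁; proj₂)
open import Data.Sum using (_⊎_; inj₁; inj₂)
open import Data.Unit using (⊤; tt)
open import Function using (_∘_)
open import Relation.Binary.Definitions using (tri<; tri≈; tri>)
open import Relation.Binary.PropositionalEquality hiding ([_])
open import Relation.Nullary using (¬_; Dec; yes; no; contradiction)

pos-*-+ : ∀ a b c → + (a ℕ.* b ℕ.+ c) ≡ + a * + b + + c
pos-*-+ a b c = trans (ℤP.pos-+ (a ℕ.* b) c) (cong (_+ + c) (ℤP.pos-* a b))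

≤∣∣ : ∀ i → i ℤ.≤ + ℤ.∣ i ∣
≤∣∣ (+ n) = ℤP.≤-refl
≤∣∣ -[1+ n ] = ℤ.-≤+

padded : ℕ → List ℕ → ℕ → List ℕ
padded a v b = replicate a 0 ++ (v ++ replicate b 0)

length-padded : ∀ a v b → length (padded a v b) ≡ a ℕ.+ (length v ℕ.+ b)
length-padded a v b = trans (LP.length-++ (replicate a 0))
  (cong₂ ℕ._+_ (LP.length-replicate a) (trans (LP.length-++ v) (cong (length v ℕ.+_) (LP.length-replicate b))))

-- Solutions of the recurrences and the rows read backwards

module Recurrence (d : ℕ) where

  open ≡-Reasoning

  Dℤ : ℕ → ℤ
  Dℤ n = + D d n

  Dℤ-rec : ∀ n → Dℤ (suc (suc n)) ≡ + d * Dℤ (suc n) + Dℤ n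
  Dℤ-rec n = pos-*-+ d (D d (suc n)) (D d n)

  NegRec : (ℕ → ℤ) → Set
  NegRec X = ∀ n → X (suc (suc n)) ≡ - (+ d * X (suc n)) + X n

  PosRec : (ℕ → ℤ) → Set
  PosRec X = ∀ n → X (suc (suc n)) ≡ + d * X (suc n) + X n

  negRec-unrolled : ∀ X → NegRec X → ∀ n → X (suc (suc n)) + + d * X (suc n) ≡ X n
  negRec-unrolled X rec n = begin
    X (suc (suc n)) + + d * X (suc n)             ≡⟨ cong (_+ + d * X (suc n)) (rec n) ⟩
    - (+ d * X (suc n)) + X n + + d * X (suc n)   ≡⟨ ring (+ d * X (suc n)) (X n) ⟩
    X n                                           ∎
    where
    ring : ∀ a b → - a + b + a ≡ b
    ring = solve-∀

  D⁻ : ℕ → ℤ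
  D⁻ zero = + 0
  D⁻ (suc zero) = + 1
  D⁻ (suc (suc n)) = - (+ d * D⁻ (suc n)) + D⁻ n

  negRec-solution : ∀ X → NegRec X → ∀ n → X (suc n) ≡ X 1 * D⁻ (suc n) + X 0 * D⁻ n
  negRec-solution X rec zero = ring (X 1) (X 0)
    where
    ring : ∀ a b → a ≡ a * + 1 + b * + 0
    ring = solve-∀
  negRec-solution X rec (suc n) = begin
    X (suc (suc n))                                  ≡⟨ negRec-solution (X ∘ suc) (rec ∘ suc) n ⟩
    X 2 * D⁻ (suc n) + X 1 * D⁻ n                    ≡⟨ cong (λ t → t * D⁻ (suc n) + X 1 * D⁻ n) (rec 0) ⟩
    (- (+ d * X 1) + X 0) * D⁻ (suc n) + X 1 * D⁻ n  ≡⟨ ring (+ d) (X 1) (X 0) (D⁻ (suc n)) (D⁻ n) ⟩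
    X 1 * D⁻ (suc (suc n)) + X 0 * D⁻ (suc n)        ∎
    where
    ring : ∀ c a b e f → (- (c * a) + b) * e + a * f ≡ a * (- (c * e) + f) + b * e
    ring = solve-∀

  negRec-agree : ∀ X Y → NegRec X → NegRec Y → X 0 ≡ Y 0 → X 1 ≡ Y 1 → ∀ n → X n ≡ Y n
  negRec-agree X Y recX recY eq₀ eq₁ zero = eq₀
  negRec-agree X Y recX recY eq₀ eq₁ (suc n) = begin
    X (suc n)                      ≡⟨ negRec-solution X recX n ⟩
    X 1 * D⁻ (suc n) + X 0 * D⁻ n  ≡⟨ cong₂ (λ a b → a * D⁻ (suc n) + b * D⁻ n) eq₁ eq₀ ⟩
    Y 1 * D⁻ (suc n) + Y 0 * D⁻ n  ≡⟨ sym (negRec-solution Y recY n) ⟩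
    Y (suc n)                      ∎

  negRec-neg : ∀ X → NegRec X → NegRec (λ n → - X n)
  negRec-neg X rec n = trans (cong -_ (rec n)) (ring (+ d) (X (suc n)) (X n))
    where
    ring : ∀ c a b → - (- (c * a) + b) ≡ - (c * - a) + - b
    ring = solve-∀

  negRec-zero : ∀ X → NegRec X → X 0 ≡ + 0 → X 1 ≡ + 0 → ∀ n → X n ≡ + 0
  negRec-zero X rec X₀≡0 X₁≡0 zero = X₀≡0
  negRec-zero X rec X₀≡0 X₁≡0 (suc n) =
    trans (negRec-solution X rec n) (cong₂ (λ a b → a * D⁻ (suc n) + b * D⁻ n) X₁≡0 X₀≡0)

  -- The value at index -m of the solution of NegRec taking the values x, y at 0, 1.
  backward : ℤ → ℤ → ℕ → ℤ
  backward x y m = y * Dℤ m + x * Dℤ (suc m)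

  backward-neg : ∀ x y m → - backward x y m ≡ backward (- x) (- y) m
  backward-neg x y m = ring x y (Dℤ m) (Dℤ (suc m))
    where
    ring : ∀ x y p q → - (y * p + x * q) ≡ - y * p + - x * q
    ring = solve-∀

  backward-suc : ∀ x y m → backward x y (suc m) ≡ backward (y + + d * x) x m
  backward-suc x y m = begin
    y * Dℤ (suc m) + x * Dℤ (suc (suc m))           ≡⟨ cong (λ t → y * Dℤ (suc m) + x * t) (Dℤ-rec m) ⟩
    y * Dℤ (suc m) + x * (+ d * Dℤ (suc m) + Dℤ m)  ≡⟨ ring x y (+ d) (Dℤ m) (Dℤ (suc m)) ⟩
    x * Dℤ m + (y + + d * x) * Dℤ (suc m)           ∎
    where
    ring : ∀ x y c p q → y * q + x * (c * q + p) ≡ x * p + (y + c * x) * q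
    ring = solve-∀

  backward-0 : ∀ x y → backward x y 0 ≡ x
  backward-0 x y = ring x y
    where
    ring : ∀ x y → y * + 0 + x * + 1 ≡ x
    ring = solve-∀

  backward-1 : ∀ x y → backward x y 1 ≡ y + + d * x
  backward-1 x y = trans (backward-suc x y 0) (backward-0 (y + + d * x) x)

  backward-nonzero : ∀ B → NegRec B → (Σ ℕ λ n → B n ≢ + 0) → ¬ (backward (B 0) (B 1) 0 ≡ + 0 × backward (B 0) (B 1) 1 ≡ + 0)
  backward-nonzero B rec (n , Bn≢0) (X₀≡0 , X₁≡0) = Bn≢0 (negRec-zero B rec B₀≡0 B₁≡0 n)
    where
    B₀≡0 : B 0 ≡ + 0
    B₀≡0 = trans (sym (backward-0 (B 0) (B 1))) X₀≡0
    B₁≡0 : B 1 ≡ + 0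
    B₁≡0 = begin
      B 1                     ≡⟨ ring (B 1) (+ d) ⟩
      B 1 + + d * + 0         ≡⟨ cong (λ x → B 1 + + d * x) (sym B₀≡0) ⟩
      B 1 + + d * B 0         ≡⟨ sym (backward-1 (B 0) (B 1)) ⟩
      backward (B 0) (B 1) 1  ≡⟨ X₁≡0 ⟩
      + 0                     ∎
      where
      ring : ∀ y c → y ≡ y + c * + 0
      ring = solve-∀

  backward-posRec : ∀ x y → PosRec (backward x y)
  backward-posRec x y m = begin
    backward x y (suc (suc m))                                          ≡⟨ backward-suc x y (suc m) ⟩
    backward (y + + d * x) x (suc m)                                    ≡⟨ backward-suc (y + + d * x) x m ⟩
    (y + + d * x) * Dℤ m + (x + + d * (y + + d * x)) * Dℤ (suc m)       ≡⟨ ring (+ d) x y (Dℤ m) (Dℤ (suc m)) ⟩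
    + d * (x * Dℤ m + (y + + d * x) * Dℤ (suc m)) + backward x y m
      ≡⟨ cong (λ t → + d * t + backward x y m) (sym (backward-suc x y m)) ⟩
    + d * backward x y (suc m) + backward x y m                         ∎
    where
    ring : ∀ c x y p q → (y + c * x) * p + (x + c * (y + c * x)) * q ≡ c * (x * p + (y + c * x) * q) + (y * p + x * q)
    ring = solve-∀

  backward-shift : ∀ B → NegRec B → ∀ N m → backward (B N) (B (suc N)) (m ℕ.+ N) ≡ backward (B 0) (B 1) m
  backward-shift B rec zero m = cong (backward (B 0) (B 1)) (ℕP.+-identityʳ m)
  backward-shift B rec (suc N) m = begin
    backward (B (suc N)) (B (suc (suc N))) (m ℕ.+ suc N)          ≡⟨ cong (backward (B (suc N)) (B (suc (suc N)))) (ℕP.+-suc m N) ⟩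
    backward (B (suc N)) (B (suc (suc N))) (suc (m ℕ.+ N))        ≡⟨ backward-suc (B (suc N)) (B (suc (suc N))) (m ℕ.+ N) ⟩
    backward (B (suc (suc N)) + + d * B (suc N)) (B (suc N)) (m ℕ.+ N)
      ≡⟨ cong (λ t → backward t (B (suc N)) (m ℕ.+ N)) (negRec-unrolled B rec N) ⟩
    backward (B N) (B (suc N)) (m ℕ.+ N)                          ≡⟨ backward-shift B rec N m ⟩
    backward (B 0) (B 1) m                                        ∎

  backward-D⁻ : ∀ p s → backward (D⁻ p) (D⁻ (suc p)) (s ℕ.+ p) ≡ Dℤ s
  backward-D⁻ p s = trans (backward-shift D⁻ (λ _ → refl) p s) (ring (Dℤ s) (Dℤ (suc s)))
    where
    ring : ∀ a b → + 1 * a + + 0 * b ≡ a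
    ring = solve-∀

  -- The row of the word u read at negative indices: for u = w k it is Abar d w k (Abar≡negRow).
  negRow : List ℕ → ℕ → ℤ
  negRow [] n = + 0
  negRow (x ∷ r) n = + x * D⁻ (n ℕ.+ length r) + negRow r n

  negRow-negRec : ∀ u → NegRec (negRow u)
  negRow-negRec [] n = sym (ring (+ d))
    where
    ring : ∀ c → - (c * + 0) + + 0 ≡ + 0
    ring = solve-∀
  negRow-negRec (x ∷ r) n = begin
    + x * D⁻ (suc (suc (n ℕ.+ q))) + negRow r (suc (suc n))
      ≡⟨ cong (λ t → + x * D⁻ (suc (suc (n ℕ.+ q))) + t) (negRow-negRec r n) ⟩
    + x * (- (+ d * D⁻ (suc (n ℕ.+ q))) + D⁻ (n ℕ.+ q)) + (- (+ d * negRow r (suc n)) + negRow r n)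
      ≡⟨ ring (+ x) (+ d) (D⁻ (suc (n ℕ.+ q))) (D⁻ (n ℕ.+ q)) (negRow r (suc n)) (negRow r n) ⟩
    - (+ d * negRow (x ∷ r) (suc n)) + negRow (x ∷ r) n  ∎
    where
    q : ℕ
    q = length r
    ring : ∀ x c a b e f → x * (- (c * a) + b) + (- (c * e) + f) ≡ - (c * (x * a + e)) + (x * b + f)
    ring = solve-∀

  valFrom-rec : ∀ s u → valFrom d (suc (suc s)) u ≡ d ℕ.* valFrom d (suc s) u ℕ.+ valFrom d s u
  valFrom-rec s [] = sym (cong (ℕ._+ 0) (ℕP.*-zeroʳ d))
  valFrom-rec s (x ∷ r) = begin
    x ℕ.* D d (suc (suc s)) ℕ.+ valFrom d (suc (suc (suc s))) r
      ≡⟨ cong (x ℕ.* D d (suc (suc s)) ℕ.+_) (valFrom-rec (suc s) r) ⟩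
    x ℕ.* (d ℕ.* D d (suc s) ℕ.+ D d s) ℕ.+ (d ℕ.* valFrom d (suc (suc s)) r ℕ.+ valFrom d (suc s) r)
      ≡⟨ ring x d (D d (suc s)) (D d s) (valFrom d (suc (suc s)) r) (valFrom d (suc s) r) ⟩
    d ℕ.* valFrom d (suc s) (x ∷ r) ℕ.+ valFrom d s (x ∷ r)  ∎
    where
    ring : ∀ x c p q a b → x ℕ.* (c ℕ.* p ℕ.+ q) ℕ.+ (c ℕ.* a ℕ.+ b) ≡ c ℕ.* (x ℕ.* p ℕ.+ a) ℕ.+ (x ℕ.* q ℕ.+ b)
    ring = ℕSolver.solve-∀

  valFrom-backward : ∀ s u → + valFrom d s u ≡ backward (negRow u 1) (negRow u 2) (s ℕ.+ length u)
  valFrom-backward s [] = refl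
  valFrom-backward s (x ∷ r) = begin
    + (x ℕ.* D d s ℕ.+ valFrom d (suc s) r)
      ≡⟨ pos-*-+ x (D d s) (valFrom d (suc s) r) ⟩
    + x * Dℤ s + + valFrom d (suc s) r
      ≡⟨ cong₂ (λ a b → + x * a + b) (sym (backward-D⁻ (suc q) s)) (valFrom-backward (suc s) r) ⟩
    + x * backward (D⁻ (suc q)) (D⁻ (suc (suc q))) (s ℕ.+ suc q) + backward (negRow r 1) (negRow r 2) (suc s ℕ.+ q)
      ≡⟨ cong (λ n → + x * backward (D⁻ (suc q)) (D⁻ (suc (suc q))) m + backward (negRow r 1) (negRow r 2) n) (sym (ℕP.+-suc s q)) ⟩
    + x * backward (D⁻ (suc q)) (D⁻ (suc (suc q))) m + backward (negRow r 1) (negRow r 2) m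
      ≡⟨ ring (+ x) (D⁻ (suc q)) (D⁻ (suc (suc q))) (negRow r 1) (negRow r 2) (Dℤ m) (Dℤ (suc m)) ⟩
    backward (negRow (x ∷ r) 1) (negRow (x ∷ r) 2) m  ∎
    where
    q : ℕ
    q = length r
    m : ℕ
    m = s ℕ.+ suc q
    ring : ∀ x a b a′ b′ p p′ → x * (b * p + a * p′) + (b′ * p + a′ * p′) ≡ (x * b + b′) * p + (x * a + a′) * p′
    ring = solve-∀

  negRow-forward : ∀ u n → negRow u (suc n) ≡ + valFrom d 0 u * D⁻ (suc (length u ℕ.+ n)) + + valFrom d 1 u * D⁻ (length u ℕ.+ n)
  negRow-forward [] n = sym (ring (D⁻ (suc n)) (D⁻ n))
    where
    ring : ∀ a b → + 0 * a + + 0 * b ≡ + 0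
    ring = solve-∀
  negRow-forward (x ∷ r) n = begin
    + x * D⁻ (suc n ℕ.+ q) + negRow r (suc n)
      ≡⟨ cong₂ (λ k t → + x * D⁻ (suc k) + t) (ℕP.+-comm n q) (negRow-forward r n) ⟩
    + x * D⁻ (suc (q ℕ.+ n)) + (+ v₀ * D⁻ (suc (q ℕ.+ n)) + + v₁ * D⁻ (q ℕ.+ n))
      ≡⟨ ring (+ x) (+ d) (+ v₀) (+ v₁) (D⁻ (suc (q ℕ.+ n))) (D⁻ (q ℕ.+ n)) ⟩
    + v₁ * D⁻ (suc (suc (q ℕ.+ n))) + (+ x + (+ d * + v₁ + + v₀)) * D⁻ (suc (q ℕ.+ n))
      ≡⟨ cong₂ (λ a b → a * D⁻ (suc (suc (q ℕ.+ n))) + b * D⁻ (suc (q ℕ.+ n))) (sym value₀) (sym value₁) ⟩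
    + valFrom d 0 (x ∷ r) * D⁻ (suc (suc (q ℕ.+ n))) + + valFrom d 1 (x ∷ r) * D⁻ (suc (q ℕ.+ n))  ∎
    where
    q : ℕ
    q = length r
    v₀ : ℕ
    v₀ = valFrom d 0 r
    v₁ : ℕ
    v₁ = valFrom d 1 r
    value₀ : + valFrom d 0 (x ∷ r) ≡ + v₁
    value₀ = cong (λ t → + (t ℕ.+ v₁)) (ℕP.*-zeroʳ x)
    value₁ : + valFrom d 1 (x ∷ r) ≡ + x + (+ d * + v₁ + + v₀)
    value₁ = begin
      + (x ℕ.* 1 ℕ.+ valFrom d 2 r)         ≡⟨ cong₂ (λ a b → + (a ℕ.+ b)) (ℕP.*-identityʳ x) (valFrom-rec 0 r) ⟩
      + (x ℕ.+ (d ℕ.* v₁ ℕ.+ v₀))           ≡⟨ ℤP.pos-+ x _ ⟩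
      + x + + (d ℕ.* v₁ ℕ.+ v₀)             ≡⟨ cong (λ t → + x + t) (pos-*-+ d v₁ v₀) ⟩
      + x + (+ d * + v₁ + + v₀)             ∎
    ring : ∀ x c a b e f → x * e + (a * e + b * f) ≡ b * (- (c * e) + f) + (x + (c * b + a)) * e
    ring = solve-∀

  backRow-negRec : ∀ a → NegRec (backRow d a)
  backRow-negRec a n = ℤP.+-comm (backRow d a n) (- (+ d * backRow d a (suc n)))

  Arow-negRow : ∀ x r n → Arow d (x ∷ r) ((+ 1 - + length (x ∷ r)) - + suc n) ≡ negRow (x ∷ r) (suc n)
  Arow-negRow x r n = begin
    Arow d u ((+ 1 - + suc q) - + suc n)    ≡⟨ cong (Arow d u) index ⟩
    backRow d a (suc (suc (q ℕ.+ n)))       ≡⟨ negRec-solution (backRow d a) (backRow-negRec a) (suc (q ℕ.+ n)) ⟩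
    backRow d a 1 * D⁻ (suc (suc (q ℕ.+ n))) + + valFrom d 1 u * D⁻ (suc (q ℕ.+ n))
      ≡⟨ cong (λ t → t * D⁻ (suc (suc (q ℕ.+ n))) + + valFrom d 1 u * D⁻ (suc (q ℕ.+ n))) backRow₁ ⟩
    + valFrom d 0 u * D⁻ (suc (suc (q ℕ.+ n))) + + valFrom d 1 u * D⁻ (suc (q ℕ.+ n))
      ≡⟨ sym (negRow-forward u n) ⟩
    negRow u (suc n)                        ∎
    where
    u : List ℕ
    u = x ∷ r
    q : ℕ
    q = length r
    a : ℕ → ℤ
    a = Apos d u
    index : (+ 1 - + suc q) - + suc n ≡ -[1+ q ℕ.+ n ]
    index = trans (ring (+ q) (+ n)) (cong (λ t → - (+ 1 + t)) (sym (ℤP.pos-+ q n)))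
      where
      ring : ∀ a b → (+ 1 - (+ 1 + a)) - (+ 1 + b) ≡ - (+ 1 + (a + b))
      ring = solve-∀
    backRow₁ : backRow d a 1 ≡ + valFrom d 0 u
    backRow₁ = begin
      + valFrom d 2 u - + d * + valFrom d 1 u                         ≡⟨ cong (λ t → + t - + d * + valFrom d 1 u) (valFrom-rec 0 u) ⟩
      + (d ℕ.* valFrom d 1 u ℕ.+ valFrom d 0 u) - + d * + valFrom d 1 u
        ≡⟨ cong (_- + d * + valFrom d 1 u) (pos-*-+ d (valFrom d 1 u) (valFrom d 0 u)) ⟩
      + d * + valFrom d 1 u + + valFrom d 0 u - + d * + valFrom d 1 u   ≡⟨ ring (+ d * + valFrom d 1 u) (+ valFrom d 0 u) ⟩
      + valFrom d 0 u                                                 ∎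
      where
      ring : ∀ a b → a + b - a ≡ b
      ring = solve-∀

  negRow-zeros : ∀ b n → negRow (replicate b 0) n ≡ + 0
  negRow-zeros zero n = refl
  negRow-zeros (suc b) n = trans (ℤP.+-identityˡ _) (negRow-zeros b n)

  negRow-zeros++ : ∀ a v n → negRow (replicate a 0 ++ v) n ≡ negRow v n
  negRow-zeros++ zero v n = refl
  negRow-zeros++ (suc a) v n = trans (ℤP.+-identityˡ _) (negRow-zeros++ a v n)

  negRow-++zeros : ∀ v b n → negRow (v ++ replicate b 0) n ≡ negRow v (n ℕ.+ b)
  negRow-++zeros [] b n = negRow-zeros b n
  negRow-++zeros (x ∷ r) b n = cong₂ (λ i t → + x * D⁻ i + t) index (negRow-++zeros r b n)
    where
    index : n ℕ.+ length (r ++ replicate b 0) ≡ n ℕ.+ b ℕ.+ length r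
    index = begin
      n ℕ.+ length (r ++ replicate b 0)            ≡⟨ cong (n ℕ.+_) (LP.length-++ r) ⟩
      n ℕ.+ (length r ℕ.+ length (replicate b 0))  ≡⟨ cong (λ l → n ℕ.+ (length r ℕ.+ l)) (LP.length-replicate b) ⟩
      n ℕ.+ (length r ℕ.+ b)                       ≡⟨ ring n (length r) b ⟩
      n ℕ.+ b ℕ.+ length r                         ∎
      where
      ring : ∀ n l b → n ℕ.+ (l ℕ.+ b) ≡ n ℕ.+ b ℕ.+ l
      ring = ℕSolver.solve-∀

  negRow-padded : ∀ a v b → negRow (padded a v b) 1 ≡ negRow v (suc b)
  negRow-padded a v b = trans (negRow-zeros++ a (v ++ replicate b 0) 1) (negRow-++zeros v b 1)

-- Signed numeration by admissible words

flip : ℤ → ℤ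
flip y = + 1 - y

flip-involutive : ∀ y → flip (flip y) ≡ y
flip-involutive = ring
  where
  ring : ∀ y → + 1 - (+ 1 - y) ≡ y
  ring = solve-∀

flip-injective : ∀ {a b} → flip a ≡ flip b → a ≡ b
flip-injective {a} {b} eq = trans (sym (flip-involutive a)) (trans (cong flip eq) (flip-involutive b))

flip-antitone : ∀ {a b} → a ℤ.≤ b → flip b ℤ.≤ flip a
flip-antitone a≤b = ℤP.+-monoʳ-≤ (+ 1) (ℤP.neg-mono-≤ a≤b)

flip-≤ : ∀ {a b} → flip a ℤ.≤ b → flip b ℤ.≤ a
flip-≤ {a} fa≤b = subst (_ ℤ.≤_) (flip-involutive a) (flip-antitone fa≤b)

digit-choice : ∀ c M P y → P ℤ.< y → y ℤ.≤ + c * M + P →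
               Σ ℕ λ k → k < c × + k * M + P ℤ.< y × y ℤ.≤ + suc k * M + P
digit-choice zero M P y P<y y≤P = contradiction (ℤP.<-≤-trans P<y y≤P) (ℤP.<-irrefl (sym (ℤP.+-identityˡ P)))
digit-choice (suc c) M P y P<y y≤top with y ℤP.≤? + c * M + P
... | yes y≤ = let k , k<c , below = digit-choice c M P y P<y y≤ in k , ℕP.m<n⇒m<1+n k<c , below
... | no y≰ = c , ℕP.n<1+n c , ℤP.≰⇒> y≰ , y≤top

0≤k*m+p : ∀ k m p → + 0 ℤ.≤ + k * + m + + p
0≤k*m+p k m p = subst (+ 0 ℤ.≤_) (pos-*-+ k m p) (ℤ.+≤+ z≤n)

head-≤ : ∀ k M P y → flip P ℤ.≤ y → + k * M + flip y ℤ.≤ + k * M + P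
head-≤ k M P y fP≤y = ℤP.+-monoʳ-≤ (+ k * M) (flip-≤ fP≤y)

head-> : ∀ k M P y → y ℤ.≤ M - P → + k * M + P ℤ.< + suc k * M + flip y
head-> k M P y y≤M-P = ℤP.suc[i]≤j⇒i<j (begin
  + 1 + (+ k * M + P)             ≡⟨ ring (+ k) M P ⟩
  (+ 1 + + k) * M + flip (M - P)  ≡⟨ cong (λ c → c * M + flip (M - P)) (sym (ℤP.pos-+ 1 k)) ⟩
  + suc k * M + flip (M - P)      ≤⟨ ℤP.+-monoʳ-≤ (+ suc k * M) (flip-antitone y≤M-P) ⟩
  + suc k * M + flip y            ∎)
  where
  open ℤP.≤-Reasoning
  ring : ∀ k M P → + 1 + (k * M + P) ≡ (+ 1 + k) * M + (+ 1 - (M - P))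
  ring = solve-∀

remainder-lower : ∀ k M P y → y ℤ.≤ + suc k * M + P → flip P ℤ.≤ flip (y - + suc k * M)
remainder-lower k M P y y≤ = flip-antitone (begin
  y - + suc k * M                  ≤⟨ ℤP.+-monoˡ-≤ (- (+ suc k * M)) y≤ ⟩
  + suc k * M + P - + suc k * M    ≡⟨ ring (+ suc k * M) P ⟩
  P                                ∎)
  where
  open ℤP.≤-Reasoning
  ring : ∀ X P → X + P - X ≡ P
  ring = solve-∀

remainder-upper : ∀ k M P y → + k * M + P ℤ.< y → flip (y - + suc k * M) ℤ.≤ M - P
remainder-upper k M P y <y = begin
  flip (y - + suc k * M)                          ≡⟨ cong (λ c → flip (y - c * M)) (ℤP.pos-+ 1 k) ⟩
  flip (y - (+ 1 + + k) * M)                      ≡⟨ ring (+ k) M P y ⟩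
  (M - P) + ((+ 1 + (+ k * M + P)) - y)           ≤⟨ ℤP.+-monoʳ-≤ (M - P) (ℤP.i≤j⇒i-j≤0 (ℤP.i<j⇒suc[i]≤j <y)) ⟩
  (M - P) + + 0                                   ≡⟨ ℤP.+-identityʳ (M - P) ⟩
  M - P                                           ∎
  where
  open ℤP.≤-Reasoning
  ring : ∀ k M P y → + 1 - (y - (+ 1 + k) * M) ≡ (M - P) + ((+ 1 + (k * M + P)) - y)
  ring = solve-∀

flip-suc : ∀ n → flip (+ suc n) ≡ - + n
flip-suc n = trans (cong (λ t → + 1 - t) (ℤP.pos-+ 1 n)) (ring (+ n))
  where
  ring : ∀ n → + 1 - (+ 1 + n) ≡ - n
  ring = solve-∀

∣∣-bounds : ∀ z → flip (+ suc ℤ.∣ z ∣) ℤ.≤ z × z ℤ.≤ + suc ℤ.∣ z ∣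
∣∣-bounds (+ n) = subst (ℤ._≤ + n) (sym (flip-suc n)) ℤP.neg-≤-pos , ℤ.+≤+ (ℕP.n≤1+n n)
∣∣-bounds -[1+ n ] = ℤP.≤-reflexive (flip-suc (suc n)) , ℤ.-≤+

twist : Bool → ℤ → ℤ
twist true = flip
twist false y = y

twist-involutive : ∀ b y → twist b (twist b y) ≡ y
twist-involutive true = flip-involutive
twist-involutive false y = refl

twist-injective : ∀ b {x y} → twist b x ≡ twist b y → x ≡ y
twist-injective b {x} {y} eq = trans (sym (twist-involutive b x)) (trans (cong (twist b) eq) (twist-involutive b y))

twist-bounds : ∀ b z → flip (+ suc ℤ.∣ z ∣) ℤ.≤ twist b z × twist b z ℤ.≤ + suc ℤ.∣ z ∣
twist-bounds true z = let lo , hi = ∣∣-bounds z in flip-antitone hi , flip-≤ lo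
twist-bounds false z = ∣∣-bounds z

even : ℕ → Bool
even zero = true
even (suc n) = not (even n)

module Numeration (d-1 : ℕ) where

  d : ℕ
  d = suc d-1

  open Recurrence d

  D-pos : ∀ n → 1 ≤ D d (suc n)
  D-pos zero = s≤s z≤n
  D-pos (suc n) = ℕP.≤-trans (D-pos n) (ℕP.≤-trans (ℕP.m≤m+n (D d (suc n)) _) (ℕP.m≤m+n _ (D d n)))

  D-mono : ∀ n → D d n ≤ D d (suc n)
  D-mono zero = z≤n
  D-mono (suc n) = ℕP.≤-trans (ℕP.m≤m+n (D d (suc n)) _) (ℕP.m≤m+n _ (D d n))

  D-mono-+ : ∀ m c → D d m ≤ D d (m ℕ.+ c)
  D-mono-+ m zero = ℕP.≤-reflexive (cong (D d) (sym (ℕP.+-identityʳ m)))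
  D-mono-+ m (suc c) = ℕP.≤-trans (D-mono-+ m c) (ℕP.≤-trans (D-mono (m ℕ.+ c)) (ℕP.≤-reflexive (cong (D d) (sym (ℕP.+-suc m c)))))

  D-double : 2 ≤ d → ∀ n → D d (suc n) ℕ.+ D d (suc n) ≤ D d (suc (suc n))
  D-double 2≤d n = begin
    D d (suc n) ℕ.+ D d (suc n)    ≡⟨ cong (D d (suc n) ℕ.+_) (sym (ℕP.+-identityʳ (D d (suc n)))) ⟩
    2 ℕ.* D d (suc n)              ≤⟨ ℕP.*-monoˡ-≤ (D d (suc n)) 2≤d ⟩
    d ℕ.* D d (suc n)              ≤⟨ ℕP.m≤m+n _ (D d n) ⟩
    D d (suc (suc n))              ∎
    where open ℕP.≤-Reasoning

  D-grow : 2 ≤ d → ∀ c m → c ℕ.* D d (suc m) < D d (suc m ℕ.+ c)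
  D-grow 2≤d zero m = ℕP.<-≤-trans (D-pos m) (D-mono-+ (suc m) 0)
  D-grow 2≤d (suc c) m = begin-strict
    D d (suc m) ℕ.+ c ℕ.* D d (suc m)         <⟨ ℕP.+-monoʳ-< (D d (suc m)) (D-grow 2≤d c m) ⟩
    D d (suc m) ℕ.+ D d (suc m ℕ.+ c)         ≤⟨ ℕP.+-monoˡ-≤ (D d (suc m ℕ.+ c)) (D-mono-+ (suc m) c) ⟩
    D d (suc m ℕ.+ c) ℕ.+ D d (suc m ℕ.+ c)   ≤⟨ D-double 2≤d (m ℕ.+ c) ⟩
    D d (suc (suc m ℕ.+ c))                   ≡⟨ cong (D d) (sym (ℕP.+-suc (suc m) c)) ⟩
    D d (suc m ℕ.+ suc c)                     ∎
    where open ℕP.≤-Reasoning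

  n≤D : 2 ≤ d → ∀ n → n ≤ D d n
  n≤D _ zero = z≤n
  n≤D _ (suc zero) = s≤s z≤n
  n≤D 2≤d (suc (suc n)) = begin
    suc (suc n)                    ≤⟨ s≤s (n≤D 2≤d (suc n)) ⟩
    suc (D d (suc n))              ≤⟨ ℕP.+-monoˡ-≤ (D d (suc n)) (D-pos n) ⟩
    D d (suc n) ℕ.+ D d (suc n)    ≤⟨ D-double 2≤d n ⟩
    D d (suc (suc n))              ∎
    where open ℕP.≤-Reasoning

  Admissible : List ℕ → Set
  Admissible u = All (_≤ d) u × Adj d u

  HeadBelow : ℕ → List ℕ → Set
  HeadBelow c [] = ⊤
  HeadBelow c (x ∷ _) = x ≤ c

  admissible-tail : ∀ {k r} → Admissible (k ∷ r) → Admissible r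
  admissible-tail {r = []} (_ ∷ _ , _) = [] , tt
  admissible-tail {r = _ ∷ _} (_ ∷ digits , _ , adj) = digits , adj

  admissible-headBelow : ∀ {u} → Admissible u → HeadBelow d u
  admissible-headBelow {[]} _ = tt
  admissible-headBelow {_ ∷ _} (k≤d ∷ _ , _) = k≤d

  admissible-nonzero-tail : ∀ {k r} → Admissible (suc k ∷ r) → HeadBelow d-1 r
  admissible-nonzero-tail {r = []} _ = tt
  admissible-nonzero-tail {r = y ∷ _} (_ ∷ y≤d ∷ _ , y≡d⇒0 , _) =
    ℕP.≤-pred (ℕP.≤∧≢⇒< y≤d (ℕP.1+n≢0 ∘ y≡d⇒0))

  0∷-admissible : ∀ {r} → Admissible r → Admissible (0 ∷ r)
  0∷-admissible {[]} (digits , _) = z≤n ∷ digits , tt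
  0∷-admissible {_ ∷ _} (digits , adj) = z≤n ∷ digits , (λ _ → refl) , adj

  ∷-admissible : ∀ {k r} → k ≤ d → HeadBelow d-1 r → Admissible r → Admissible (k ∷ r)
  ∷-admissible {r = []} k≤d _ (digits , _) = k≤d ∷ digits , tt
  ∷-admissible {r = _ ∷ _} k≤d y<d (digits , adj) =
    k≤d ∷ digits , (λ { refl → contradiction y<d (ℕP.n≮n d-1) }) , adj

  -- altVal u is negRow u 1 up to the involution flip (negRow-altVal); with this normalisation
  -- its values on the admissible words of length q fill the interval [1 - D_q, D_{q+1}].
  altVal : List ℕ → ℤ
  altVal [] = + 1
  altVal (k ∷ r) = + k * Dℤ (suc (length r)) + flip (altVal r)

  -- The largest value of altVal on admissible words of length q with head digit at most c.
  top : ℕ → ℕ → ℤ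
  top c zero = + 1
  top c (suc q) = + c * Dℤ (suc q) + Dℤ q

  top-d : ∀ q → top d q ≡ Dℤ (suc q)
  top-d zero = refl
  top-d (suc q) = sym (Dℤ-rec q)

  top-d-1 : ∀ q → top d-1 q ≡ Dℤ (suc q) - Dℤ q
  top-d-1 zero = refl
  top-d-1 (suc q) = begin
    + d-1 * Dℤ (suc q) + Dℤ q                       ≡⟨ ring (+ d-1) (Dℤ (suc q)) (Dℤ q) ⟩
    (+ 1 + + d-1) * Dℤ (suc q) + Dℤ q - Dℤ (suc q)
      ≡⟨ cong (λ c → c * Dℤ (suc q) + Dℤ q - Dℤ (suc q)) (sym (ℤP.pos-+ 1 d-1)) ⟩
    + d * Dℤ (suc q) + Dℤ q - Dℤ (suc q)            ≡⟨ cong (_- Dℤ (suc q)) (sym (Dℤ-rec q)) ⟩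
    Dℤ (suc (suc q)) - Dℤ (suc q)                   ∎
    where
    open ≡-Reasoning
    ring : ∀ c M P → c * M + P ≡ (+ 1 + c) * M + P - M
    ring = solve-∀

  altVal-lower : ∀ {u} → Admissible u → flip (Dℤ (length u)) ℤ.≤ altVal u
  altVal-upper : ∀ c {u} → Admissible u → HeadBelow c u → altVal u ℤ.≤ top c (length u)

  altVal-head-≤ : ∀ {k r} → Admissible (k ∷ r) →
                  altVal (k ∷ r) ℤ.≤ + k * Dℤ (suc (length r)) + Dℤ (length r)
  altVal-head-≤ {k} {r} adm = head-≤ k _ _ (altVal r) (altVal-lower (admissible-tail adm))

  altVal-head-> : ∀ {k r} → Admissible (suc k ∷ r) →
                  + k * Dℤ (suc (length r)) + Dℤ (length r) ℤ.< altVal (suc k ∷ r)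
  altVal-head-> {k} {r} adm = head-> k _ _ (altVal r)
    (subst (altVal r ℤ.≤_) (top-d-1 (length r)) (altVal-upper d-1 (admissible-tail adm) (admissible-nonzero-tail adm)))

  altVal-lower {[]} _ = ℤP.≤-refl
  altVal-lower {zero ∷ r} adm =
    subst (flip (Dℤ (suc (length r))) ℤ.≤_) (sym (ℤP.+-identityˡ (flip (altVal r))))
      (flip-antitone (subst (altVal r ℤ.≤_) (top-d (length r))
        (altVal-upper d (admissible-tail adm) (admissible-headBelow (admissible-tail adm)))))
  altVal-lower {suc k ∷ r} adm = ℤP.≤-trans (ℤP.i≤j⇒i-j≤0 (ℤ.+≤+ (D-pos (length r))))
    (ℤP.≤-trans (0≤k*m+p k _ _) (ℤP.<⇒≤ (altVal-head-> adm)))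

  altVal-upper c {[]} _ _ = ℤP.≤-refl
  altVal-upper c {k ∷ r} adm k≤c = ℤP.≤-trans (altVal-head-≤ adm)
    (ℤP.+-monoˡ-≤ (Dℤ (length r)) (ℤP.*-monoʳ-≤-nonNeg (Dℤ (suc (length r))) (ℤ.+≤+ k≤c)))

  altVal-surjective : ∀ c q → c ≤ d → ∀ y → flip (Dℤ q) ℤ.≤ y → y ℤ.≤ top c q →
    Σ (List ℕ) λ u → Admissible u × HeadBelow c u × length u ≡ q × altVal u ≡ y
  altVal-surjective c zero c≤d y lo hi with ℤP.≤-antisym lo hi
  ... | refl = [] , ([] , tt) , tt , refl , refl
  altVal-surjective c (suc q) c≤d y lo hi with y ℤP.≤? Dℤ q
  ... | yes y≤P =
    let r , adm , _ , len , val = altVal-surjective d q ℕP.≤-refl (flip y) (flip-antitone y≤P)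
                                    (subst (flip y ℤ.≤_) (sym (top-d q)) (flip-≤ lo))
    in 0 ∷ r , 0∷-admissible adm , z≤n , cong suc len ,
       trans (ℤP.+-identityˡ (flip (altVal r))) (trans (cong flip val) (flip-involutive y))
  ... | no y≰P =
    let k , k<c , above , below = digit-choice c M P y (ℤP.≰⇒> y≰P) hi
        r , adm , headBelow , len , val = altVal-surjective d-1 q (ℕP.n≤1+n d-1) (flip (y - + suc k * M))
                                            (remainder-lower k M P y below)
                                            (subst (flip (y - + suc k * M) ℤ.≤_) (sym (top-d-1 q)) (remainder-upper k M P y above))
    in suc k ∷ r , ∷-admissible (ℕP.≤-trans k<c c≤d) headBelow adm , k<c , cong suc len ,
       trans (cong₂ (λ n v → + suc k * Dℤ (suc n) + flip v) len val) (ring (+ suc k * M) y)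
    where
    M : ℤ
    M = Dℤ (suc q)
    P : ℤ
    P = Dℤ q
    ring : ∀ X y → X + (+ 1 - (+ 1 - (y - X))) ≡ y
    ring = solve-∀

  altVal-head-< : ∀ {k k′ r r′} → Admissible (k ∷ r) → Admissible (k′ ∷ r′) → length r ≡ length r′ → k < k′ →
                  altVal (k ∷ r) ℤ.< altVal (k′ ∷ r′)
  altVal-head-< {k} {suc j} {r} {r′} adm adm′ len (s≤s k≤j) = begin-strict
    altVal (k ∷ r)                              ≤⟨ altVal-head-≤ adm ⟩
    + k * Dℤ (suc (length r)) + Dℤ (length r)
      ≤⟨ ℤP.+-monoˡ-≤ (Dℤ (length r)) (ℤP.*-monoʳ-≤-nonNeg (Dℤ (suc (length r))) (ℤ.+≤+ k≤j)) ⟩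
    + j * Dℤ (suc (length r)) + Dℤ (length r)
      <⟨ subst (λ n → + j * Dℤ (suc n) + Dℤ n ℤ.< altVal (suc j ∷ r′)) (sym len) (altVal-head-> adm′) ⟩
    altVal (suc j ∷ r′)                         ∎
    where open ℤP.≤-Reasoning

  altVal-injective : ∀ {u u′} → Admissible u → Admissible u′ → length u ≡ length u′ → altVal u ≡ altVal u′ → u ≡ u′
  altVal-injective {[]} {[]} _ _ _ _ = refl
  altVal-injective {k ∷ r} {k′ ∷ r′} adm adm′ len val with ℕP.<-cmp k k′
  ... | tri< k<k′ _ _ = contradiction val (ℤP.<⇒≢ (altVal-head-< adm adm′ (ℕP.suc-injective len) k<k′))
  ... | tri> _ _ k′<k = contradiction (sym val) (ℤP.<⇒≢ (altVal-head-< adm′ adm (sym (ℕP.suc-injective len)) k′<k))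
  ... | tri≈ _ refl _ = cong (k ∷_) (altVal-injective (admissible-tail adm) (admissible-tail adm′) (ℕP.suc-injective len)
                          (flip-injective (∙-cancelˡ (+ k * Dℤ (suc (length r))) _ _
                            (trans val (cong (λ n → + k * Dℤ (suc n) + flip (altVal r′)) (sym (ℕP.suc-injective len)))))))

  D⁻-alternates : ∀ q → D⁻ q ≡ (if even q then - Dℤ q else Dℤ q)
  D⁻-alternates zero = refl
  D⁻-alternates (suc zero) = refl
  D⁻-alternates (suc (suc q)) with even q | D⁻-alternates q | D⁻-alternates (suc q)
  ... | true | D⁻q | D⁻q+1 = begin
    - (+ d * D⁻ (suc q)) + D⁻ q              ≡⟨ cong₂ (λ a b → - (+ d * a) + b) D⁻q+1 D⁻q ⟩
    - (+ d * Dℤ (suc q)) + - Dℤ q            ≡⟨ ring (+ d * Dℤ (suc q)) (Dℤ q) ⟩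
    - (+ d * Dℤ (suc q) + Dℤ q)              ≡⟨ cong -_ (sym (Dℤ-rec q)) ⟩
    - Dℤ (suc (suc q))                       ∎
    where
    open ≡-Reasoning
    ring : ∀ a b → - a + - b ≡ - (a + b)
    ring = solve-∀
  ... | false | D⁻q | D⁻q+1 = begin
    - (+ d * D⁻ (suc q)) + D⁻ q              ≡⟨ cong₂ (λ a b → - (+ d * a) + b) D⁻q+1 D⁻q ⟩
    - (+ d * - Dℤ (suc q)) + Dℤ q            ≡⟨ ring (+ d) (Dℤ (suc q)) (Dℤ q) ⟩
    + d * Dℤ (suc q) + Dℤ q                  ≡⟨ sym (Dℤ-rec q) ⟩
    Dℤ (suc (suc q))                         ∎
    where
    open ≡-Reasoning
    ring : ∀ c a b → - (c * - a) + b ≡ c * a + b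
    ring = solve-∀

  negRow-altVal : ∀ u → negRow u 1 ≡ twist (even (length u)) (altVal u)
  negRow-altVal [] = refl
  negRow-altVal (k ∷ r) with even (length r) | D⁻-alternates (suc (length r)) | negRow-altVal r
  ... | true | D⁻q+1 | IH = cong₂ (λ a b → + k * a + b) D⁻q+1 IH
  ... | false | D⁻q+1 | IH =
    trans (cong₂ (λ a b → + k * a + b) D⁻q+1 IH) (ring (+ k) (Dℤ (suc (length r))) (altVal r))
    where
    ring : ∀ k a y → k * - a + y ≡ + 1 - (k * a + (+ 1 - y))
    ring = solve-∀

  negRow-surjective : 2 ≤ d → ∀ z → Σ (List ℕ) λ u → Admissible u × negRow u 1 ≡ z
  negRow-surjective 2≤d z =
    let u , adm , _ , len , val = altVal-surjective d q ℕP.≤-refl (twist b z) lo hi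
    in u , adm , (begin
      negRow u 1                           ≡⟨ negRow-altVal u ⟩
      twist (even (length u)) (altVal u)   ≡⟨ cong₂ (λ n y → twist (even n) y) len val ⟩
      twist b (twist b z)                  ≡⟨ twist-involutive b z ⟩
      z                                    ∎)
    where
    open ≡-Reasoning
    q : ℕ
    q = suc ℤ.∣ z ∣
    b : Bool
    b = even q
    q≤Dq : + q ℤ.≤ Dℤ q
    q≤Dq = ℤ.+≤+ (n≤D 2≤d q)
    lo : flip (Dℤ q) ℤ.≤ twist b z
    lo = ℤP.≤-trans (flip-antitone q≤Dq) (proj₁ (twist-bounds b z))
    hi : twist b z ℤ.≤ top d q
    hi = ℤP.≤-trans (proj₂ (twist-bounds b z))
           (ℤP.≤-trans q≤Dq (ℤP.≤-trans (ℤ.+≤+ (D-mono q)) (ℤP.≤-reflexive (sym (top-d q)))))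

  valFrom-bound : ∀ {u} s → Admissible u → valFrom d (suc s) u ℕ.+ D d s ≤ D d (suc s ℕ.+ length u)
  valFrom-bound-headBelow : ∀ {u} s → Admissible u → HeadBelow d-1 u →
                            valFrom d (suc s) u ℕ.+ D d (suc s) ≤ D d (suc s ℕ.+ length u)

  valFrom-bound {[]} s _ = subst (D d s ≤_) (cong (D d) (sym (ℕP.+-identityʳ (suc s)))) (D-mono s)
  valFrom-bound {zero ∷ r} s adm = begin
    valFrom d (suc (suc s)) r ℕ.+ D d s            ≤⟨ ℕP.+-monoʳ-≤ (valFrom d (suc (suc s)) r) (D-mono s) ⟩
    valFrom d (suc (suc s)) r ℕ.+ D d (suc s)      ≤⟨ valFrom-bound (suc s) (admissible-tail adm) ⟩
    D d (suc (suc s) ℕ.+ length r)                 ≡⟨ cong (D d) (sym (ℕP.+-suc (suc s) (length r))) ⟩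
    D d (suc s ℕ.+ suc (length r))                 ∎
    where open ℕP.≤-Reasoning
  valFrom-bound {suc x ∷ r} s adm@(x<d ∷ _ , _) = begin
    suc x ℕ.* D d (suc s) ℕ.+ v ℕ.+ D d s          ≡⟨ ring (suc x ℕ.* D d (suc s)) v (D d s) ⟩
    v ℕ.+ (suc x ℕ.* D d (suc s) ℕ.+ D d s)        ≤⟨ ℕP.+-monoʳ-≤ v (ℕP.+-monoˡ-≤ (D d s) (ℕP.*-monoˡ-≤ (D d (suc s)) x<d)) ⟩
    v ℕ.+ D d (suc (suc s))                        ≤⟨ valFrom-bound-headBelow (suc s) (admissible-tail adm) (admissible-nonzero-tail adm) ⟩
    D d (suc (suc s) ℕ.+ length r)                 ≡⟨ cong (D d) (sym (ℕP.+-suc (suc s) (length r))) ⟩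
    D d (suc s ℕ.+ suc (length r))                 ∎
    where
    open ℕP.≤-Reasoning
    v : ℕ
    v = valFrom d (suc (suc s)) r
    ring : ∀ a v b → a ℕ.+ v ℕ.+ b ≡ v ℕ.+ (a ℕ.+ b)
    ring = ℕSolver.solve-∀

  valFrom-bound-headBelow {[]} s _ _ = ℕP.≤-reflexive (cong (D d) (sym (ℕP.+-identityʳ (suc s))))
  valFrom-bound-headBelow {zero ∷ r} s adm _ = ℕP.≤-trans (valFrom-bound (suc s) (admissible-tail adm))
    (ℕP.≤-reflexive (cong (D d) (sym (ℕP.+-suc (suc s) (length r)))))
  valFrom-bound-headBelow {suc x ∷ r} s adm x<d-1 = begin
    suc x ℕ.* D d (suc s) ℕ.+ v ℕ.+ D d (suc s)    ≡⟨ ring (suc x) (D d (suc s)) v ⟩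
    v ℕ.+ suc (suc x) ℕ.* D d (suc s)              ≤⟨ ℕP.+-monoʳ-≤ v (ℕP.*-monoˡ-≤ (D d (suc s)) (s≤s x<d-1)) ⟩
    v ℕ.+ d ℕ.* D d (suc s)                        ≤⟨ ℕP.+-monoʳ-≤ v (ℕP.m≤m+n (d ℕ.* D d (suc s)) (D d s)) ⟩
    v ℕ.+ D d (suc (suc s))                        ≤⟨ valFrom-bound-headBelow (suc s) (admissible-tail adm) (admissible-nonzero-tail adm) ⟩
    D d (suc (suc s) ℕ.+ length r)                 ≡⟨ cong (D d) (sym (ℕP.+-suc (suc s) (length r))) ⟩
    D d (suc s ℕ.+ suc (length r))                 ∎
    where
    open ℕP.≤-Reasoning
    v : ℕ
    v = valFrom d (suc (suc s)) r
    ring : ∀ x a v → x ℕ.* a ℕ.+ v ℕ.+ a ≡ v ℕ.+ (1 ℕ.+ x) ℕ.* a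
    ring = ℕSolver.solve-∀

  valFrom-<-D : ∀ {u} s → Admissible u → valFrom d (suc (suc s)) u < D d (suc (suc s) ℕ.+ length u)
  valFrom-<-D s adm = ℕP.<-≤-trans (ℕP.m<m+n _ (D-pos s)) (valFrom-bound (suc s) adm)

  negRow-injective : ∀ {u u′} → Admissible u → Admissible u′ → length u ≡ length u′ → negRow u 1 ≡ negRow u′ 1 → u ≡ u′
  negRow-injective {u} {u′} adm adm′ len eq = altVal-injective adm adm′ len (twist-injective (even (length u)) (begin
    twist (even (length u)) (altVal u)     ≡⟨ sym (negRow-altVal u) ⟩
    negRow u 1                             ≡⟨ eq ⟩
    negRow u′ 1                            ≡⟨ negRow-altVal u′ ⟩
    twist (even (length u′)) (altVal u′)   ≡⟨ cong (λ n → twist (even n) (altVal u′)) (sym len) ⟩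
    twist (even (length u)) (altVal u′)    ∎))
    where open ≡-Reasoning

-- Leading and trailing zeros

++[x]≢[] : ∀ u {x : ℕ} → u ++ [ x ] ≢ []
++[x]≢[] [] ()
++[x]≢[] (_ ∷ _) ()

lastNonzero-nonempty : ¬ LastNonzero []
lastNonzero-nonempty (u , _ , eq , _) = ++[x]≢[] u (sym eq)

lastNonzero-∷ : ∀ {y p} → LastNonzero p → LastNonzero (y ∷ p)
lastNonzero-∷ {y} (u , x , refl , x≢0) = y ∷ u , x , refl , x≢0

lastNonzero-zeros++ : ∀ a {p} → LastNonzero p → LastNonzero (replicate a 0 ++ p)
lastNonzero-zeros++ zero lnz = lnz
lastNonzero-zeros++ (suc a) lnz = lastNonzero-∷ (lastNonzero-zeros++ a lnz)

lastNonzero-tail : ∀ {x y r} → LastNonzero (x ∷ y ∷ r) → LastNonzero (y ∷ r)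
lastNonzero-tail ([] , _ , () , _)
lastNonzero-tail (_ ∷ u , x , eq , x≢0) = u , x , LP.∷-injectiveʳ eq , x≢0

lastNonzero-[0] : ¬ LastNonzero [ 0 ]
lastNonzero-[0] ([] , _ , refl , 0≢0) = 0≢0 refl
lastNonzero-[0] (_ ∷ u , _ , eq , _) = ++[x]≢[] u (sym (LP.∷-injectiveʳ eq))

trailing-zeros : ∀ u → u ≡ replicate (length u) 0 ⊎ Σ (List ℕ) λ p → Σ ℕ λ b → LastNonzero p × u ≡ p ++ replicate b 0
trailing-zeros [] = inj₁ refl
trailing-zeros (y ∷ r) with trailing-zeros r
... | inj₂ (p , b , lnz , r≡) = inj₂ (y ∷ p , b , lastNonzero-∷ lnz , cong (y ∷_) r≡)
... | inj₁ r≡0s with y ℕP.≟ 0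
...   | yes refl = inj₁ (cong (0 ∷_) r≡0s)
...   | no y≢0 = inj₂ ([ y ] , length r , ([] , y , refl , y≢0) , cong (y ∷_) r≡0s)

zeros-prefix : ∀ b u {x t} → replicate b 0 ≡ (u ++ [ x ]) ++ t → x ≡ 0
zeros-prefix (suc b) [] eq = sym (LP.∷-injectiveˡ eq)
zeros-prefix (suc b) (_ ∷ u) eq = zeros-prefix b u (LP.∷-injectiveʳ eq)

++zeros-injective : ∀ {p p′} b b′ → LastNonzero p → LastNonzero p′ →
                    p ++ replicate b 0 ≡ p′ ++ replicate b′ 0 → p ≡ p′ × b ≡ b′
++zeros-injective b b′ (u , x , refl , x≢0) (u′ , x′ , refl , x′≢0) = cancel u u′
  where
  cancel : ∀ u u′ → (u ++ [ x ]) ++ replicate b 0 ≡ (u′ ++ [ x′ ]) ++ replicate b′ 0 → u ++ [ x ] ≡ u′ ++ [ x′ ] × b ≡ b′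
  cancel [] [] eq with LP.∷-injective eq
  ... | refl , zeros = refl , trans (sym (LP.length-replicate b)) (trans (cong length zeros) (LP.length-replicate b′))
  cancel [] (_ ∷ u′) eq = contradiction (zeros-prefix b u′ (LP.∷-injectiveʳ eq)) x′≢0
  cancel (_ ∷ u) [] eq = contradiction (zeros-prefix b′ u (sym (LP.∷-injectiveʳ eq))) x≢0
  cancel (y ∷ u) (y′ ∷ u′) eq with LP.∷-injective eq
  ... | refl , eq′ = let p≡p′ , b≡b′ = cancel u u′ eq′ in cong (y ∷_) p≡p′ , b≡b′

module Words (d-1 : ℕ) where

  open Numeration d-1
  open Recurrence d

  zeros++-admissible : ∀ a {w} → Admissible w → Admissible (replicate a 0 ++ w)
  zeros++-admissible zero adm = adm
  zeros++-admissible (suc a) adm = 0∷-admissible (zeros++-admissible a adm)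

  headBelow-++zeros : ∀ {c} r b → HeadBelow c r → HeadBelow c (r ++ replicate b 0)
  headBelow-++zeros [] zero _ = tt
  headBelow-++zeros [] (suc b) _ = z≤n
  headBelow-++zeros (_ ∷ _) b h = h

  headBelow-++⁻ˡ : ∀ {c} p {s} → HeadBelow c (p ++ s) → HeadBelow c p
  headBelow-++⁻ˡ [] _ = tt
  headBelow-++⁻ˡ (_ ∷ _) h = h

  ++zeros-admissible : ∀ {w} b → Admissible w → Admissible (w ++ replicate b 0)
  ++zeros-admissible {[]} zero _ = [] , tt
  ++zeros-admissible {[]} (suc b) adm = 0∷-admissible (++zeros-admissible b adm)
  ++zeros-admissible {zero ∷ r} b adm = 0∷-admissible (++zeros-admissible b (admissible-tail adm))
  ++zeros-admissible {suc x ∷ r} b adm@(x<d ∷ _ , _) =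
    ∷-admissible x<d (headBelow-++zeros r b (admissible-nonzero-tail adm)) (++zeros-admissible b (admissible-tail adm))

  padded-admissible : ∀ a b {v} → Admissible v → Admissible (padded a v b)
  padded-admissible a b adm = zeros++-admissible a (++zeros-admissible b adm)

  admissible-++⁻ˡ : ∀ p {s} → Admissible (p ++ s) → Admissible p
  admissible-++⁻ˡ [] _ = [] , tt
  admissible-++⁻ˡ (zero ∷ p) adm = 0∷-admissible (admissible-++⁻ˡ p (admissible-tail adm))
  admissible-++⁻ˡ (suc x ∷ p) adm@(x<d ∷ _ , _) =
    ∷-admissible x<d (headBelow-++⁻ˡ p (admissible-nonzero-tail adm)) (admissible-++⁻ˡ p (admissible-tail adm))

  ostrowski-zeros++ : ∀ a {w} → IsOstrowski d w → IsOstrowski d (replicate a 0 ++ w)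
  ostrowski-zeros++ zero ost = ost
  ostrowski-zeros++ (suc a) (_ , adm) = s≤s z≤n , zeros++-admissible (suc a) adm

  zeros++-trimmed-injective : ∀ a a′ {v v′} → IsTrimmed d v → IsTrimmed d v′ →
                              replicate a 0 ++ v ≡ replicate a′ 0 ++ v′ → v ≡ v′
  zeros++-trimmed-injective zero zero _ _ eq = eq
  zeros++-trimmed-injective (suc a) (suc a′) tr tr′ eq = zeros++-trimmed-injective a a′ tr tr′ (LP.∷-injectiveʳ eq)
  zeros++-trimmed-injective zero (suc a′) {v′ = v′} (_ , _ , untrimmable) (ost′ , _) eq =
    contradiction (replicate a′ 0 ++ v′ , eq , ostrowski-zeros++ a′ ost′) untrimmable
  zeros++-trimmed-injective (suc a) zero {v} (ost , _) (_ , _ , untrimmable′) eq =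
    contradiction (replicate a 0 ++ v , sym eq , ostrowski-zeros++ a ost) untrimmable′

  padded-injective : ∀ a a′ b b′ {v v′} → IsTrimmed d v → IsTrimmed d v′ →
                     padded a v b ≡ padded a′ v′ b′ → v ≡ v′ × b ≡ b′
  padded-injective a a′ b b′ {v} {v′} tr tr′ eq =
    let a0v≡a′0v′ , b≡b′ = ++zeros-injective b b′
                             (lastNonzero-zeros++ a (proj₁ (proj₂ tr))) (lastNonzero-zeros++ a′ (proj₁ (proj₂ tr′)))
                             (trans (LP.++-assoc (replicate a 0) v _) (trans eq (sym (LP.++-assoc (replicate a′ 0) v′ _))))
    in zeros++-trimmed-injective a a′ tr tr′ a0v≡a′0v′ , b≡b′

  strip-leading-zeros : ∀ w → IsOstrowski d w → LastNonzero w →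
                        Σ ℕ λ a → Σ (List ℕ) λ v → w ≡ replicate a 0 ++ v × IsTrimmed d v
  strip-leading-zeros [] _ lnz = contradiction lnz lastNonzero-nonempty
  strip-leading-zeros (suc x ∷ r) ost lnz = 0 , suc x ∷ r , refl , ost , lnz , λ { (_ , () , _) }
  strip-leading-zeros (zero ∷ []) _ lnz = contradiction lnz lastNonzero-[0]
  strip-leading-zeros (zero ∷ y ∷ r) ost lnz =
    strip-next (y ℕP.<? d) (λ y<d → strip-leading-zeros (y ∷ r) (y<d , admissible-tail (proj₂ ost)) (lastNonzero-tail lnz))
    where
    strip-next : Dec (y < d) → (y < d → Σ ℕ λ a → Σ (List ℕ) λ v → y ∷ r ≡ replicate a 0 ++ v × IsTrimmed d v) →
                 Σ ℕ λ a → Σ (List ℕ) λ v → zero ∷ y ∷ r ≡ replicate a 0 ++ v × IsTrimmed d v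
    strip-next (yes y<d) strip-tail = let a , v , eq , tr = strip-tail y<d in suc a , v , cong (0 ∷_) eq , tr
    strip-next (no y≮d) _ = 0 , zero ∷ y ∷ r , refl , ost , lnz , λ { (_ , refl , (y<d , _)) → y≮d y<d }

  -- Prepending a zero makes the first digit admissible, so that strip-leading-zeros applies.
  admissible-normal-form : ∀ {u} → Admissible u →
    (∀ n → negRow u n ≡ + 0) ⊎ Σ ℕ λ b → Σ (List ℕ) λ v → IsTrimmed d v × (∀ n → negRow u n ≡ negRow v (n ℕ.+ b))
  admissible-normal-form {u} adm with trailing-zeros u
  ... | inj₁ u≡0s = inj₁ λ n → trans (cong (λ t → negRow t n) u≡0s) (negRow-zeros (length u) n)
  ... | inj₂ (p , b , lnz , u≡) =
    let a , v , 0p≡ , tr = strip-leading-zeros (0 ∷ p) (s≤s z≤n , 0∷-admissible (admissible-++⁻ˡ p (subst Admissible u≡ adm)))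
                             (lastNonzero-∷ lnz)
    in inj₂ (b , v , tr , λ n → begin
      negRow u n                          ≡⟨ cong (λ t → negRow t n) u≡ ⟩
      negRow (p ++ replicate b 0) n       ≡⟨ negRow-++zeros p b n ⟩
      negRow p (n ℕ.+ b)                  ≡⟨ sym (ℤP.+-identityˡ _) ⟩
      negRow (0 ∷ p) (n ℕ.+ b)            ≡⟨ cong (λ t → negRow t (n ℕ.+ b)) 0p≡ ⟩
      negRow (replicate a 0 ++ v) (n ℕ.+ b) ≡⟨ negRow-zeros++ a v (n ℕ.+ b) ⟩
      negRow v (n ℕ.+ b)                  ∎)
    where open ≡-Reasoning

-- Eventual sign of solutions of the positive recurrence

EventuallyPositive : (ℕ → ℤ) → Set
EventuallyPositive X = Σ ℕ λ M → ∀ m → M ≤ m → + 0 ℤ.< X m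

EventuallySigned : (ℕ → ℤ) → Set
EventuallySigned X = EventuallyPositive X ⊎ EventuallyPositive (λ n → - X n)

eventuallyPositive-suc : ∀ {X} → EventuallyPositive (X ∘ suc) → EventuallyPositive X
eventuallyPositive-suc (M , pos) = suc M , λ { (suc m) (s≤s M≤m) → pos m M≤m }

eventuallyPositive-cong : ∀ {X Y} → (∀ n → X n ≡ Y n) → EventuallyPositive X → EventuallyPositive Y
eventuallyPositive-cong X≗Y (M , pos) = M , λ m M≤m → subst (+ 0 ℤ.<_) (X≗Y m) (pos m M≤m)

eventuallySigned-suc : ∀ {X} → EventuallySigned (X ∘ suc) → EventuallySigned X
eventuallySigned-suc (inj₁ pos) = inj₁ (eventuallyPositive-suc pos)
eventuallySigned-suc (inj₂ neg) = inj₂ (eventuallyPositive-suc neg)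

eventuallySigned-neg : ∀ {X} → EventuallySigned (λ n → - X n) → EventuallySigned X
eventuallySigned-neg (inj₁ neg) = inj₂ neg
eventuallySigned-neg {X} (inj₂ pos) = inj₁ (eventuallyPositive-cong (ℤP.neg-involutive ∘ X) pos)

module EventualSign (d-1 : ℕ) where

  open Recurrence (suc d-1)

  posRec-neg : ∀ X → PosRec X → PosRec (λ n → - X n)
  posRec-neg X rec n = trans (cong -_ (rec n)) (ring (+ suc d-1) (X (suc n)) (X n))
    where
    ring : ∀ c a b → - (c * a + b) ≡ c * - a + - b
    ring = solve-∀

  posRec-pos₀ : ∀ X → PosRec X → + 0 ℤ.< X 0 → + 0 ℤ.≤ X 1 → + 0 ℤ.< X 2
  posRec-pos₀ X rec 0<X0 0≤X1 = subst (+ 0 ℤ.<_) (sym (rec 0))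
    (ℤP.+-mono-≤-< (subst (ℤ._≤ + suc d-1 * X 1) (ℤP.*-zeroʳ (+ suc d-1)) (ℤP.*-monoˡ-≤-nonNeg (+ suc d-1) 0≤X1)) 0<X0)

  posRec-pos₁ : ∀ X → PosRec X → + 0 ℤ.≤ X 0 → + 0 ℤ.< X 1 → + 0 ℤ.< X 2
  posRec-pos₁ X rec 0≤X0 0<X1 = subst (+ 0 ℤ.<_) (sym (rec 0))
    (ℤP.+-mono-<-≤ (subst (ℤ._< + suc d-1 * X 1) (ℤP.*-zeroʳ (+ suc d-1)) (ℤP.*-monoˡ-<-pos (+ suc d-1) 0<X1)) 0≤X0)

  positive-from : ∀ X → PosRec X → + 0 ℤ.≤ X 0 → + 0 ℤ.< X 1 → ∀ m → + 0 ℤ.< X (suc m)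
  positive-from X rec 0≤X0 0<X1 zero = 0<X1
  positive-from X rec 0≤X0 0<X1 (suc m) = positive-from (X ∘ suc) (rec ∘ suc) (ℤP.<⇒≤ 0<X1) (posRec-pos₁ X rec 0≤X0 0<X1) m

  eventuallyPositive-start : ∀ X → PosRec X → + 0 ℤ.< X 0 → + 0 ℤ.≤ X 1 → EventuallyPositive X
  eventuallyPositive-start X rec 0<X0 0≤X1 =
    2 , λ { (suc (suc m)) _ → positive-from (X ∘ suc) (rec ∘ suc) 0≤X1 (posRec-pos₀ X rec 0<X0 0≤X1) m
            ; (suc zero) (s≤s ()) }

  -- Euclid-like descent: while the signs alternate, |X n| + |X (1 + n)| decreases strictly.
  descent : ∀ fuel X → PosRec X → + 0 ℤ.< X 0 → X 1 ℤ.≤ + 0 → X 0 - X 1 ℤ.≤ + fuel → EventuallySigned X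
  descent zero X rec 0<X0 X1≤0 size≤0 =
    contradiction (ℤP.≤-<-trans (ℤP.≤-trans (ℤP.i-j≤0⇒i≤j size≤0) X1≤0) 0<X0) (ℤP.<-irrefl refl)
  descent (suc fuel) X rec 0<X0 X1≤0 size≤ with X 1 ℤP.≟ + 0 | X 2 ℤP.≤? + 0
  ... | yes X1≡0 | _ = inj₁ (eventuallyPositive-start X rec 0<X0 (ℤP.≤-reflexive (sym X1≡0)))
  ... | no X1≢0 | yes X2≤0 =
    inj₂ (eventuallyPositive-suc {λ n → - X n}
      (eventuallyPositive-start (λ n → - X (suc n)) (posRec-neg (X ∘ suc) (rec ∘ suc)) (ℤP.neg-mono-< X1<0) (ℤP.neg-mono-≤ X2≤0)))
    where
    X1<0 : X 1 ℤ.< + 0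
    X1<0 = ℤP.≤∧≢⇒< X1≤0 X1≢0
  ... | no X1≢0 | no X2≰0 =
    eventuallySigned-suc {X} (eventuallySigned-neg {X ∘ suc}
      (descent fuel (λ n → - X (suc n)) (posRec-neg (X ∘ suc) (rec ∘ suc)) (ℤP.neg-mono-< X1<0) (ℤP.neg-mono-≤ (ℤP.<⇒≤ (ℤP.≰⇒> X2≰0))) size′≤))
    where
    X1<0 : X 1 ℤ.< + 0
    X1<0 = ℤP.≤∧≢⇒< X1≤0 X1≢0
    X2<X0 : X 2 ℤ.< X 0
    X2<X0 = subst (ℤ._< X 0) (sym (rec 0)) (subst (λ t → + suc d-1 * X 1 + X 0 ℤ.< t) (ℤP.+-identityˡ (X 0))
              (ℤP.+-monoˡ-< (X 0) (subst (+ suc d-1 * X 1 ℤ.<_) (ℤP.*-zeroʳ (+ suc d-1)) (ℤP.*-monoˡ-<-pos (+ suc d-1) X1<0))))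
    size′≤ : - X 1 - - X 2 ℤ.≤ + fuel
    size′≤ = ℤP.i<j⇒i≤pred[j] (ℤP.<-≤-trans (subst (ℤ._< X 0 - X 1) (ring (X 1) (X 2)) (ℤP.+-monoˡ-< (- X 1) X2<X0)) size≤)
      where
      ring : ∀ a b → b - a ≡ - a - - b
      ring = solve-∀

  eventually-signed⁺ : ∀ X → PosRec X → + 0 ℤ.< X 0 → EventuallySigned X
  eventually-signed⁺ X rec 0<X0 with X 1 ℤP.≤? + 0
  ... | no X1≰0 = inj₁ (eventuallyPositive-start X rec 0<X0 (ℤP.<⇒≤ (ℤP.≰⇒> X1≰0)))
  ... | yes X1≤0 = descent ℤ.∣ X 0 - X 1 ∣ X rec 0<X0 X1≤0 (≤∣∣ (X 0 - X 1))

  eventually-signed≢0 : ∀ X → PosRec X → X 0 ≢ + 0 → EventuallySigned X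
  eventually-signed≢0 X rec X0≢0 with ℤP.<-cmp (X 0) (+ 0)
  ... | tri< X0<0 _ _ = eventuallySigned-neg {X} (eventually-signed⁺ (λ n → - X n) (posRec-neg X rec) (ℤP.neg-mono-< X0<0))
  ... | tri≈ _ X0≡0 _ = contradiction X0≡0 X0≢0
  ... | tri> _ _ 0<X0 = eventually-signed⁺ X rec 0<X0

  eventually-signed : ∀ X → PosRec X → ¬ (X 0 ≡ + 0 × X 1 ≡ + 0) → EventuallySigned X
  eventually-signed X rec nonzero with X 0 ℤP.≟ + 0
  ... | no X0≢0 = eventually-signed≢0 X rec X0≢0
  ... | yes X0≡0 = eventuallySigned-suc {X} (eventually-signed≢0 (X ∘ suc) (rec ∘ suc) (λ X1≡0 → nonzero (X0≡0 , X1≡0)))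

-- Tails of solutions of the negative recurrence

*-≤-∣∣* : ∀ x n → x * + n ℤ.≤ + (ℤ.∣ x ∣ ℕ.* n)
*-≤-∣∣* x n = subst (x * + n ℤ.≤_) (cong +_ (ℤP.∣i*j∣≡∣i∣*∣j∣ x (+ n))) (≤∣∣ (x * + n))

∣⊖∣< : ∀ {α β n} → α < n → β < n → ℤ.∣ α ℤ.⊖ β ∣ < n
∣⊖∣< {α} {β} α<n β<n with α ℕP.≤? β
... | yes α≤β = ℕP.≤-<-trans (ℕP.≤-reflexive (ℤP.∣⊖∣-≤ α≤β)) (ℕP.≤-<-trans (ℕP.m∸n≤m β α) β<n)
... | no α≰β = ℕP.≤-<-trans (ℕP.≤-reflexive (trans (ℤP.∣m⊖n∣≡∣n⊖m∣ α β) (ℤP.∣⊖∣-< (ℕP.≰⇒> α≰β))))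
                (ℕP.≤-<-trans (ℕP.m∸n≤m α β) α<n)

multiple-squeeze : ∀ δ n {a b} → + 0 ℤ.≤ a → a ℤ.< + n → + 0 ℤ.≤ b → b ℤ.< + n → δ * + n ≡ a - b → δ ≡ + 0
multiple-squeeze δ n {+ α} {+ β} _ (ℤ.+<+ α<n) _ (ℤ.+<+ β<n) eq = ℤP.∣i∣≡0⇒i≡0 (factor≡0 (subst (_< n) ∣δ∣*n≡ (∣⊖∣< α<n β<n)))
  where
  ∣δ∣*n≡ : ℤ.∣ α ℤ.⊖ β ∣ ≡ ℤ.∣ δ ∣ ℕ.* n
  ∣δ∣*n≡ = trans (cong ℤ.∣_∣ (sym (trans eq (ℤP.[+m]-[+n]≡m⊖n α β)))) (ℤP.∣i*j∣≡∣i∣*∣j∣ δ (+ n))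
  factor≡0 : ∀ {m} → m ℕ.* n < n → m ≡ 0
  factor≡0 {zero} _ = refl
  factor≡0 {suc m} sm*n<n = contradiction (ℕP.<-≤-trans sm*n<n (ℕP.m≤m+n n (m ℕ.* n))) (ℕP.<-irrefl refl)

tailEquiv-shift : ∀ {X Y} a N → (∀ t → X (t ℕ.+ a) ≡ Y (t ℕ.+ N)) → TailEquiv X Y
tailEquiv-shift {X} {Y} a N X≡Y = + N - + a , a , λ n a≤n → begin
  X n                       ≡⟨ cong X (sym (ℕP.m∸n+n≡m a≤n)) ⟩
  X (n ∸ a ℕ.+ a)           ≡⟨ X≡Y (n ∸ a) ⟩
  Y (n ∸ a ℕ.+ N)           ≡⟨ cong (Y ∘ ℤ.∣_∣) (index n a≤n) ⟩
  Y ℤ.∣ + n + (+ N - + a) ∣ ∎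
  where
  open ≡-Reasoning
  index : ∀ n → a ≤ n → + (n ∸ a ℕ.+ N) ≡ + n + (+ N - + a)
  index n a≤n = begin
    + (n ∸ a ℕ.+ N)                    ≡⟨ ℤP.pos-+ (n ∸ a) N ⟩
    + (n ∸ a) + + N                    ≡⟨ ring (+ (n ∸ a)) (+ N) (+ a) ⟩
    (+ (n ∸ a) + + a) + (+ N - + a)    ≡⟨ cong (_+ (+ N - + a)) (sym (ℤP.pos-+ (n ∸ a) a)) ⟩
    + (n ∸ a ℕ.+ a) + (+ N - + a)      ≡⟨ cong (λ t → + t + (+ N - + a)) (ℕP.m∸n+n≡m a≤n) ⟩
    + n + (+ N - + a)                  ∎
    where
    ring : ∀ x N a → x + N ≡ (x + a) + (N - a)
    ring = solve-∀

module Tail (d-1 : ℕ) (2≤d : 2 ≤ suc d-1) where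

  open Numeration d-1
  open Recurrence d

  backward-bound : ∀ x y m → backward x y m ℤ.< Dℤ (suc m ℕ.+ (ℤ.∣ x ∣ ℕ.+ ℤ.∣ y ∣))
  backward-bound x y m = begin-strict
    y * Dℤ m + x * Dℤ (suc m)                                        ≤⟨ ℤP.+-mono-≤ (*-≤-∣∣* y (D d m)) (*-≤-∣∣* x (D d (suc m))) ⟩
    + (ℤ.∣ y ∣ ℕ.* D d m) + + (ℤ.∣ x ∣ ℕ.* D d (suc m))              ≤⟨ ℤP.+-monoˡ-≤ (+ (ℤ.∣ x ∣ ℕ.* D d (suc m))) (ℤ.+≤+ (ℕP.*-monoʳ-≤ ℤ.∣ y ∣ (D-mono m))) ⟩
    + (ℤ.∣ y ∣ ℕ.* D d (suc m)) + + (ℤ.∣ x ∣ ℕ.* D d (suc m))        ≡⟨ sym (ℤP.pos-+ (ℤ.∣ y ∣ ℕ.* D d (suc m)) (ℤ.∣ x ∣ ℕ.* D d (suc m))) ⟩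
    + (ℤ.∣ y ∣ ℕ.* D d (suc m) ℕ.+ ℤ.∣ x ∣ ℕ.* D d (suc m))          ≡⟨ cong +_ (ring ℤ.∣ x ∣ ℤ.∣ y ∣ (D d (suc m))) ⟩
    + ((ℤ.∣ x ∣ ℕ.+ ℤ.∣ y ∣) ℕ.* D d (suc m))                        <⟨ ℤ.+<+ (D-grow 2≤d (ℤ.∣ x ∣ ℕ.+ ℤ.∣ y ∣) m) ⟩
    Dℤ (suc m ℕ.+ (ℤ.∣ x ∣ ℕ.+ ℤ.∣ y ∣))                             ∎
    where
    open ℤP.≤-Reasoning
    ring : ∀ a b p → b ℕ.* p ℕ.+ a ℕ.* p ≡ (a ℕ.+ b) ℕ.* p
    ring = ℕSolver.solve-∀

  threshold : (ℕ → ℤ) → ℕ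
  threshold B = suc (ℤ.∣ B 0 ∣ ℕ.+ ℤ.∣ B 1 ∣)

  backward-threshold-< : ∀ B → NegRec B → ∀ m →
                         backward (B (threshold B)) (B (suc (threshold B))) (m ℕ.+ threshold B) ℤ.< Dℤ (m ℕ.+ threshold B)
  backward-threshold-< B rec m =
    subst₂ ℤ._<_ (sym (backward-shift B rec (threshold B) m)) (cong Dℤ (sym (ℕP.+-suc m _))) (backward-bound (B 0) (B 1) m)

  -- Far to the left, B and the row of u take values in [0, D_j) which, by backward, differ by
  -- (B (1 + N) - negRow u 2) * D_j; hence the entries at 1 + N agree.
  representative-agrees : ∀ B → NegRec B → EventuallyPositive (backward (B 0) (B 1)) → ∀ {u} → Admissible u →
                          negRow u 1 ≡ B (threshold B) →
                          negRow u 2 ≡ B (suc (threshold B)) × ¬ (∀ n → negRow u n ≡ + 0)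
  representative-agrees B rec (M , pos) {u} adm u₁ = u₂ , λ allZero → ℤP.<-irrefl (sym (α≡0 allZero)) 0<α
    where
    open ≡-Reasoning
    N : ℕ
    N = threshold B
    L : ℕ
    L = length u
    m : ℕ
    m = M ℕ.+ suc (suc L)
    j : ℕ
    j = m ℕ.+ N
    s : ℕ
    s = suc (suc (M ℕ.+ N))
    s+L≡j : s ℕ.+ L ≡ j
    s+L≡j = ring M N L
      where
      ring : ∀ M N L → suc (suc (M ℕ.+ N)) ℕ.+ L ≡ M ℕ.+ suc (suc L) ℕ.+ N
      ring = ℕSolver.solve-∀
    α : ℤ
    α = backward (B N) (B (suc N)) j
    0<α : + 0 ℤ.< α
    0<α = subst (+ 0 ℤ.<_) (sym (backward-shift B rec N m)) (pos m (ℕP.m≤m+n M _))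
    α<Dj : α ℤ.< Dℤ j
    α<Dj = backward-threshold-< B rec m
    β : ℤ
    β = + valFrom d s u
    β≡ : β ≡ backward (B N) (negRow u 2) j
    β≡ = trans (valFrom-backward s u) (cong₂ (λ x n → backward x (negRow u 2) n) u₁ s+L≡j)
    β<Dj : β ℤ.< Dℤ j
    β<Dj = ℤ.+<+ (subst (λ n → valFrom d s u < D d n) s+L≡j (valFrom-<-D (M ℕ.+ N) adm))
    difference : (B (suc N) - negRow u 2) * Dℤ j ≡ α - β
    difference = begin
      (B (suc N) - negRow u 2) * Dℤ j                    ≡⟨ ring (B (suc N)) (negRow u 2) (B N) (Dℤ j) (Dℤ (suc j)) ⟩
      α - backward (B N) (negRow u 2) j                  ≡⟨ cong (λ t → α - t) (sym β≡) ⟩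
      α - β                                              ∎
      where
      ring : ∀ y y′ x p q → (y - y′) * p ≡ (y * p + x * q) - (y′ * p + x * q)
      ring = solve-∀
    u₂ : negRow u 2 ≡ B (suc N)
    u₂ = sym (ℤP.i-j≡0⇒i≡j _ _
           (multiple-squeeze _ (D d j) (ℤP.<⇒≤ 0<α) α<Dj (ℤ.+≤+ z≤n) β<Dj difference))
    α≡0 : (∀ n → negRow u n ≡ + 0) → α ≡ + 0
    α≡0 allZero = cong₂ (λ x y → backward x y j) (trans (sym u₁) (allZero 1)) (trans (sym u₂) (allZero 2))

  representative-tail : ∀ B → NegRec B → ∀ {u} → negRow u 1 ≡ B (threshold B) → negRow u 2 ≡ B (suc (threshold B)) →
                        ∀ t → B (t ℕ.+ threshold B) ≡ negRow u (suc t)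
  representative-tail B rec {u} u₁ u₂ =
    negRec-agree (λ t → B (t ℕ.+ threshold B)) (negRow u ∘ suc)
                 (λ t → rec (t ℕ.+ threshold B)) (negRow-negRec u ∘ suc) (sym u₁) (sym u₂)

-- The negative Ostrowski array

module Array (d-1 : ℕ) (2≤d : 2 ≤ suc d-1) (w : ℕ → List ℕ) (enum : IsTrimmedEnumeration (suc d-1) w) where

  open Recurrence (suc d-1)
  open Numeration d-1
  open Words d-1
  open EventualSign d-1
  open Tail d-1 2≤d

  private
    trimmed : ∀ m → 1 ≤ m → IsTrimmed d (w m)
    trimmed = proj₁ enum
    increasing : ∀ m → 1 ≤ m → val d (w m) < val d (w (suc m))
    increasing = proj₁ (proj₂ enum)
    exhaustive : ∀ v → IsTrimmed d v → Σ ℕ λ m → (1 ≤ m) × (w m ≡ v)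
    exhaustive = proj₂ (proj₂ enum)

  Abar≡negRow : ∀ {k} → 1 ≤ k → ∀ n → Abar d w k (suc n) ≡ negRow (w k) (suc n)
  Abar≡negRow {k} k≥1 = row-of-trimmed (w k) (trimmed k k≥1)
    where
    row-of-trimmed : ∀ v → IsTrimmed d v → ∀ n → Arow d v ((+ 1 - + length v) - + suc n) ≡ negRow v (suc n)
    row-of-trimmed [] (_ , lnz , _) = contradiction lnz lastNonzero-nonempty
    row-of-trimmed (x ∷ r) _ = Arow-negRow x r

  val-increasing : ∀ {m m′} → 1 ≤ m → m < m′ → val d (w m) < val d (w m′)
  val-increasing {m} {suc m′} m≥1 (s≤s m≤m′) with ℕP.m≤n⇒m<n∨m≡n m≤m′
  ... | inj₁ m<m′ = ℕP.<-trans (val-increasing m≥1 m<m′) (increasing m′ (ℕP.≤-trans m≥1 m≤m′))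
  ... | inj₂ refl = increasing m m≥1

  w-injective : ∀ {m m′} → 1 ≤ m → 1 ≤ m′ → w m ≡ w m′ → m ≡ m′
  w-injective {m} {m′} m≥1 m′≥1 eq with ℕP.<-cmp m m′
  ... | tri< m<m′ _ _ = contradiction (cong (val d) eq) (ℕP.<⇒≢ (val-increasing m≥1 m<m′))
  ... | tri≈ _ m≡m′ _ = m≡m′
  ... | tri> _ _ m′<m = contradiction (cong (val d) (sym eq)) (ℕP.<⇒≢ (val-increasing m′≥1 m′<m))

  Abar-negRec : (k n : ℕ) → 1 ≤ k → 2 ≤ n → Abar d w k (suc n) ≡ - (+ d * Abar d w k n) + Abar d w k (n ∸ 1)
  Abar-negRec _ (suc zero) _ (s≤s ())
  Abar-negRec k (suc (suc n)) k≥1 _ = begin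
    Abar d w k (suc (suc (suc n)))                                   ≡⟨ Abar≡negRow k≥1 (suc (suc n)) ⟩
    negRow (w k) (suc (suc (suc n)))                                 ≡⟨ negRow-negRec (w k) (suc n) ⟩
    - (+ d * negRow (w k) (suc (suc n))) + negRow (w k) (suc n)      ≡⟨ cong₂ (λ a b → - (+ d * a) + b) (sym (Abar≡negRow k≥1 (suc n))) (sym (Abar≡negRow k≥1 n)) ⟩
    - (+ d * Abar d w k (suc (suc n))) + Abar d w k (suc n)          ∎
    where open ≡-Reasoning

  Abar-occurrence : ∀ z → z ≢ + 0 → Σ ℕ λ k → Σ ℕ λ n → 1 ≤ k × Abar d w k (suc n) ≡ z
  Abar-occurrence z z≢0 with negRow-surjective 2≤d z
  ... | u , adm , u₁≡z with admissible-normal-form adm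
  ...   | inj₁ allZero = contradiction (trans (sym u₁≡z) (allZero 1)) z≢0
  ...   | inj₂ (b , v , tr , u≗v) with exhaustive v tr
  ...     | k , k≥1 , wk≡v = k , b , k≥1 , (begin
    Abar d w k (suc b)     ≡⟨ Abar≡negRow k≥1 b ⟩
    negRow (w k) (suc b)   ≡⟨ cong (λ v → negRow v (suc b)) wk≡v ⟩
    negRow v (suc b)       ≡⟨ sym (u≗v 1) ⟩
    negRow u 1             ≡⟨ u₁≡z ⟩
    z                      ∎)
    where open ≡-Reasoning

  -- Padding both words with zeros to a common length reduces to the injectivity of negRow _ 1.
  Abar-injective : ∀ {k n k′ n′} → 1 ≤ k → 1 ≤ k′ → Abar d w k (suc n) ≡ Abar d w k′ (suc n′) → k ≡ k′ × n ≡ n′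
  Abar-injective {k} {n} {k′} {n′} k≥1 k′≥1 eq =
    let wk≡wk′ , n≡n′ = padded-injective a a′ n n′ (trimmed k k≥1) (trimmed k′ k′≥1)
                          (negRow-injective (admissible k≥1 a n) (admissible k′≥1 a′ n′) same-length same-value)
    in w-injective k≥1 k′≥1 wk≡wk′ , n≡n′
    where
    open ≡-Reasoning
    a : ℕ
    a = length (w k′) ℕ.+ n′
    a′ : ℕ
    a′ = length (w k) ℕ.+ n
    admissible : ∀ {k} → 1 ≤ k → ∀ a b → Admissible (padded a (w k) b)
    admissible {k} k≥1 a b = padded-admissible a b (proj₂ (proj₁ (trimmed k k≥1)))
    same-length : length (padded a (w k) n) ≡ length (padded a′ (w k′) n′)
    same-length = trans (length-padded a (w k) n) (trans (ℕP.+-comm a a′) (sym (length-padded a′ (w k′) n′)))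
    same-value : negRow (padded a (w k) n) 1 ≡ negRow (padded a′ (w k′) n′) 1
    same-value = begin
      negRow (padded a (w k) n) 1       ≡⟨ negRow-padded a (w k) n ⟩
      negRow (w k) (suc n)              ≡⟨ sym (Abar≡negRow k≥1 n) ⟩
      Abar d w k (suc n)                ≡⟨ eq ⟩
      Abar d w k′ (suc n′)              ≡⟨ Abar≡negRow k′≥1 n′ ⟩
      negRow (w k′) (suc n′)            ≡⟨ sym (negRow-padded a′ (w k′) n′) ⟩
      negRow (padded a′ (w k′) n′) 1    ∎

  Abar-occurs-once : (z : ℤ) → z ≢ + 0 →
    Σ ℕ λ k → Σ ℕ λ n → (1 ≤ k) × (1 ≤ n) × (Abar d w k n ≡ z)
      × ((k′ n′ : ℕ) → 1 ≤ k′ → 1 ≤ n′ → Abar d w k′ n′ ≡ z → (k′ ≡ k) × (n′ ≡ n))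
  Abar-occurs-once z z≢0 =
    let k , n , k≥1 , Abar≡z = Abar-occurrence z z≢0
    in k , suc n , k≥1 , s≤s z≤n , Abar≡z , λ { k′ (suc n′) k′≥1 _ Abar′≡z →
         let k′≡k , n′≡n = Abar-injective k′≥1 k≥1 (trans Abar′≡z (sym Abar≡z)) in k′≡k , cong suc n′≡n }

  tail-from-normal-form : ∀ {B k u b v} N → 1 ≤ k → w k ≡ v → (∀ n → negRow u n ≡ negRow v (n ℕ.+ b)) →
                          (∀ t → B (t ℕ.+ N) ≡ negRow u (suc t)) → TailEquiv (Abar d w k) B
  tail-from-normal-form {B} {k} {u} {b} {v} N k≥1 wk≡v u≗v B≗u = tailEquiv-shift {Abar d w k} {B} (suc b) N λ t → begin
    Abar d w k (t ℕ.+ suc b)       ≡⟨ cong (Abar d w k) (ℕP.+-suc t b) ⟩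
    Abar d w k (suc (t ℕ.+ b))     ≡⟨ Abar≡negRow k≥1 (t ℕ.+ b) ⟩
    negRow (w k) (suc t ℕ.+ b)     ≡⟨ cong (λ v → negRow v (suc t ℕ.+ b)) wk≡v ⟩
    negRow v (suc t ℕ.+ b)         ≡⟨ sym (u≗v (suc t)) ⟩
    negRow u (suc t)               ≡⟨ sym (B≗u t) ⟩
    B (t ℕ.+ N)                    ∎
    where open ≡-Reasoning

  Abar-tail : ∀ B → NegRec B → EventuallyPositive (backward (B 0) (B 1)) → Σ ℕ λ k → 1 ≤ k × TailEquiv (Abar d w k) B
  Abar-tail B rec pos with negRow-surjective 2≤d (B (threshold B))
  ... | u , adm , u₁ with admissible-normal-form adm
  ...   | inj₁ allZero = contradiction allZero (proj₂ (representative-agrees B rec pos adm u₁))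
  ...   | inj₂ (b , v , tr , u≗v) with exhaustive v tr
  ...     | k , k≥1 , wk≡v = k , k≥1 , tail-from-normal-form {B} {k} {u} {b} {v} (threshold B) k≥1 wk≡v u≗v
                                 (representative-tail B rec {u} u₁ (proj₁ (representative-agrees B rec pos adm u₁)))

  Abar-tail-equivalent : (B : ℕ → ℤ) → NegRec B → (Σ ℕ λ n → B n ≢ + 0) →
    Σ ℕ λ k → (1 ≤ k) × (TailEquiv (Abar d w k) B ⊎ TailEquiv (Abar d w k) (λ n → - B n))
  Abar-tail-equivalent B rec nonzero
    with eventually-signed (backward (B 0) (B 1)) (backward-posRec (B 0) (B 1)) (backward-nonzero B rec nonzero)
  ... | inj₁ pos = let k , k≥1 , tail = Abar-tail B rec pos in k , k≥1 , inj₁ tail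
  ... | inj₂ neg = let k , k≥1 , tail = Abar-tail (λ n → - B n) (negRec-neg B rec)
                                          (eventuallyPositive-cong (backward-neg (B 0) (B 1)) neg)
                   in k , k≥1 , inj₂ tail

theorem3 : (d : ℕ) → 2 ≤ d → (w : ℕ → List ℕ) → IsTrimmedEnumeration d w →
    ((k n : ℕ) → 1 ≤ k → 2 ≤ n →
        Abar d w k (suc n) ≡ - (+ d * Abar d w k n) + Abar d w k (n ∸ 1))
    × ((z : ℤ) → z ≢ + 0 →
        Σ ℕ λ k → Σ ℕ λ n → (1 ≤ k) × (1 ≤ n) × (Abar d w k n ≡ z)
          × ((k′ n′ : ℕ) → 1 ≤ k′ → 1 ≤ n′ → Abar d w k′ n′ ≡ z → (k′ ≡ k) × (n′ ≡ n)))
    × ((B : ℕ → ℤ) → ((n : ℕ) → B (suc (suc n)) ≡ - (+ d * B (suc n)) + B n) →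
        (Σ ℕ λ n → B n ≢ + 0) →
        Σ ℕ λ k → (1 ≤ k) × (TailEquiv (Abar d w k) B ⊎ TailEquiv (Abar d w k) (λ n → - B n)))
theorem3 (suc d-1) 2≤d w enum = Abar-negRec , Abar-occurs-once , Abar-tail-equivalent
  where open Array d-1 2≤d w enum
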